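{- Let $q\ge 6$ be a prime power and let $\mathcal V$ be a ruled quintic surface in $\mathrm{PG}(6,q)$. Then: (1) no two generators of $\mathcal V$ lie in a common plane; (2) no three generators of $\mathcal V$ lie in a common $4$-space; (3) no four generators of $\mathcal V$ lie in a common $5$-space.
   Context: Construction: in $\mathrm{PG}(6,q)$ let $\alpha$ be a plane and $\Pi_3$ a $3$-space with $\alpha\cap\Pi_3=\emptyset$. Let $\mathcal C$ be a non-degenerate conic in $\alpha$ and $\mathcal N_3$ a twisted cubic in $\Pi_3$, parametrised as $\mathcal C=\{(1,\theta,\theta^2)\}$ and $\mathcal N_3=\{(1,\epsilon,\epsilon^2,\epsilon^3)\}$ ($\theta,\epsilon\in\mathbb F_q\cup\{\infty\}$) in coordinates of $\alpha$, resp. $\Pi_3$, and let $\phi\in\mathrm{PGL}(2,q)$ act on parameters, giving a bijection from $\mathcal C$ to $\mathcal N_3$. The ruled quintic surface $\mathcal V$ is the set of points on the $q+1$ lines (generators) joining each point of $\mathcal C$ to its image under $\phi$; $\mathcal C$ is its conic directrix. -}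

module Defs where

open import Level using (0ℓ)
open import Data.Nat using (ℕ; zero; suc; _^_)
open import Data.Nat.Primality using (Prime)
open import Data.Fin using (Fin; zero; suc)
open import Data.Product using (Σ; ∃; _×_; _,_)
open import Relation.Nullary using (¬_)
open import Relation.Binary.PropositionalEquality using (_≡_)
open import Algebra.Bundles using (CommutativeRing)

record Field : Set₁ where
  field
    commRing : CommutativeRing 0ℓ 0ℓ
  open CommutativeRing commRing public
  field
    1≉0     : ¬ (1# ≈ 0#)
    inverse : ∀ x → ¬ (x ≈ 0#) → ∃ λ y → (x * y) ≈ 1#

record HasSize (F : Field) (q : ℕ) : Set where
  open Field F
  field
    enum       : Fin q → Carrier
    enum-inj   : ∀ i j → enum i ≈ enum j → i ≡ j
    enum-surj  : ∀ x → ∃ λ i → enum i ≈ x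

IsPrimePower : ℕ → Set
IsPrimePower q = Σ ℕ λ p → Σ ℕ λ k → Prime p × (q ≡ p ^ suc k)

module PG (F : Field) where
  open Field F using (Carrier; _≈_; _+_; _*_; _-_; 0#; 1#)

  -- homogeneous coordinate vectors of PG(n-1, F)
  Vect : ℕ → Set
  Vect n = Fin n → Carrier

  sumFin : ∀ {m} → (Fin m → Carrier) → Carrier
  sumFin {zero}  f = 0#
  sumFin {suc m} f = f zero + sumFin (λ i → f (suc i))

  InSpan : ∀ {n m} → (Fin m → Vect n) → Vect n → Set
  InSpan {n} {m} ws v = ∃ λ (a : Fin m → Carrier) →
    ∀ (i : Fin n) → v i ≈ sumFin (λ j → a j * ws j i)

  -- A subspace of projective dimension (at most) k is the span of k+1
  -- vectors; every subspace of dimension ≤ k lies in one of dimension k.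

  -- Parameters of F ∪ {∞} in homogeneous form: (s , t) ≠ (0 , 0),
  -- θ = t/s: (1,θ) ↔ θ ∈ F, (0,1) ↔ ∞.
  Param : Set
  Param = Carrier × Carrier

  NonZeroParam : Param → Set
  NonZeroParam (s , t) = ¬ ((s ≈ 0#) × (t ≈ 0#))

  SameParam : Param → Param → Set
  SameParam (s , t) (s' , t') = (s * t') ≈ (t * s')

  record PGL2 : Set where
    field
      a b c d : Carrier
      det≉0   : ¬ ((a * d - b * c) ≈ 0#)

  -- parameter (s , t) stands for θ = t/s  (s = 0 means θ = ∞);
  -- φ acts by θ ↦ (aθ+b)/(cθ+d), i.e. (s , t) ↦ (c t + d s , a t + b s)
  act : PGL2 → Param → Param
  act φ (s , t) = ((c * t + d * s) , (a * t + b * s))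
    where open PGL2 φ

  -- coordinates of PG(6,F): indices 0,1,2 span the plane α,
  -- indices 3,4,5,6 span the solid Π₃ (α ∩ Π₃ = ∅)
  -- conic point (1, θ, θ²) in α, homogeneously (s², s t, t²)
  conicPt : Param → Vect 7
  conicPt (s , t) zero                                   = s * s
  conicPt (s , t) (suc zero)                             = s * t
  conicPt (s , t) (suc (suc zero))                       = t * t
  conicPt (s , t) (suc (suc (suc _)))                    = 0#

  -- twisted cubic point (1, ε, ε², ε³) in Π₃, homogeneously (s³, s²t, st², t³)
  cubicPt : Param → Vect 7
  cubicPt (s , t) (suc (suc (suc zero)))                         = s * s * s
  cubicPt (s , t) (suc (suc (suc (suc zero))))                   = s * s * t
  cubicPt (s , t) (suc (suc (suc (suc (suc zero)))))             = s * t * t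
  cubicPt (s , t) (suc (suc (suc (suc (suc (suc zero))))))       = t * t * t
  cubicPt (s , t) _                                              = 0#

  genPt : PGL2 → Param → Carrier → Carrier → Vect 7
  genPt φ θ l m i = l * conicPt θ i + m * cubicPt (act φ θ) i

  GenInSpan : ∀ {m} → PGL2 → Param → (Fin m → Vect 7) → Set
  GenInSpan φ θ ws = ∀ l m → InSpan ws (genPt φ θ l m)

  DistinctParams : ∀ {r} → (Fin r → Param) → Set
  DistinctParams θs = (∀ i → NonZeroParam (θs i)) ×
                      (∀ i j → SameParam (θs i) (θs j) → i ≡ j)

  InCommonSpace : ∀ {r} → PGL2 → (Fin r → Param) → ℕ → Set
  InCommonSpace φ θs k = ∃ λ (ws : Fin (suc k) → Vect 7) → ∀ i → GenInSpan φ (θs i) ws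

module Submission where

-- Write P(θ) = (s², st, t², 0,0,0,0) for the point of the conic C with parameter θ = (s : t) and
-- N(η) = (0,0,0, s³, s²t, st², t³) for the point of the twisted cubic N₃.  To every tuple ρ of two parameters belongs a linear functional on F⁷ whose value at
-- P(θ) is L(ρ₀,θ)·L(ρ₁,θ), where L(A,θ) = s_A t − t_A s vanishes exactly when θ = A; it vanishes on
-- all of Π₃.  Likewise every triple of parameters gives a functional vanishing on α whose value at
-- N(η) is a product of three such linear factors.  Hence any three distinct points of C and any four
-- distinct points of N₃ carry a dual family of functionals (each vanishes at all but one of the points),
-- so together they are linearly independent.  r generators in a common k-space would put
-- min(r,3) + r such points (4, 6, 7 for r = 2, 3, 4) in the span of k+1 = 3, 5, 6 vectors, which is
-- impossible: more vectors than the dimension of their span are linearly dependent (Gaussian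
-- elimination), and a linear dependence is killed by the dual family.
--
-- The argument works over every field with
-- decidable equality.

open import Defs
open import Data.Nat using (ℕ; _≥_)
open import Data.Fin using (Fin)
open import Data.Product using (_×_)
open import Relation.Nullary using (¬_)

open import Level using (0ℓ)
open import Function using (_∘_; id)
open import Algebra.Bundles using (CommutativeRing; RawRing)
open import Data.Nat as ℕ using (zero; suc; _≤_; z≤n; s≤s)
import Data.Nat.Properties as ℕₚ
open import Data.Fin as Fin using (zero; suc; #_; punchIn; punchOut; splitAt; inject₁)
open import Data.Fin.Properties
  using (punchIn-punchOut; punchInᵢ≢i; suc-injective; splitAt⁻¹-↑ˡ; splitAt⁻¹-↑ʳ;
         inject₁-injective)
open import Data.Vec.Functional using (_++_)
open import Data.Product using (∃; _,_; proj₁; proj₂)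
open import Data.Sum using (_⊎_; inj₁; inj₂)
open import Data.Maybe using (Maybe; just; nothing)
open import Relation.Nullary using (yes; no)
open import Relation.Binary.Definitions using (Decidable)
open import Relation.Binary.PropositionalEquality as ≡ using (_≡_; _≢_)
import Algebra.Solver.Ring.AlmostCommutativeRing as ACR

-- An integer is a
-- pair (a , b) of naturals standing for a − b, always in the normal form where one component is 0,
-- so that equal coefficients are syntactically equal and the solver can compare them.
module IntegerCoefficientSolver (R : CommutativeRing 0ℓ 0ℓ) where
  open CommutativeRing R
  open import Algebra.Properties.Semiring.Mult semiring using (×-homo-+; ×1-homo-*) renaming (_×_ to _⊗_)
  open import Algebra.Properties.Ring ring using (-‿distribˡ-*; -‿distribʳ-*)
  open import Algebra.Properties.Group +-group using (⁻¹-involutive; ε⁻¹≈ε)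
  open import Algebra.Properties.AbelianGroup +-abelianGroup using (⁻¹-∙-comm)
  open import Algebra.Properties.CommutativeSemigroup +-commutativeSemigroup using (interchange)
  open import Relation.Binary.Reasoning.Setoid setoid

  ℤ₂ : Set
  ℤ₂ = ℕ × ℕ

  difference : ℕ → ℕ → ℤ₂
  difference x y = (x ℕ.∸ y , y ℕ.∸ x)

  integers : RawRing 0ℓ 0ℓ
  integers = record
    { Carrier = ℤ₂ ; _≈_ = _≡_
    ; _+_ = λ { (a , b) (c , d) → difference (a ℕ.+ c) (b ℕ.+ d) }
    ; _*_ = λ { (a , b) (c , d) → difference (a ℕ.* c ℕ.+ b ℕ.* d) (a ℕ.* d ℕ.+ b ℕ.* c) }
    ; -_ = λ { (a , b) → (b , a) }
    ; 0# = (0 , 0) ; 1# = (1 , 0) }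

  ⟦_⟧ℤ : ℤ₂ → Carrier
  ⟦ (a , b) ⟧ℤ = a ⊗ 1# - b ⊗ 1#

  sub-interchange : ∀ a b c d → (a + c) - (b + d) ≈ (a - b) + (c - d)
  sub-interchange a b c d = begin
    (a + c) + - (b + d)    ≈⟨ +-congˡ (sym (⁻¹-∙-comm b d)) ⟩
    (a + c) + (- b + - d)  ≈⟨ interchange a c (- b) (- d) ⟩
    (a - b) + (c - d)      ∎

  sub-product : ∀ a b c d → (a * c + b * d) - (a * d + b * c) ≈ (a - b) * (c - d)
  sub-product a b c d = sym (begin
    (a - b) * (c - d)                                  ≈⟨ distribʳ _ _ _ ⟩
    a * (c - d) + - b * (c - d)                        ≈⟨ +-cong (distribˡ _ _ _) (distribˡ _ _ _) ⟩
    (a * c + a * - d) + (- b * c + - b * - d)          ≈⟨ +-cong (+-congˡ (sym (-‿distribʳ-* a d)))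
                                                                 (+-cong (sym (-‿distribˡ-* b c)) minus-minus) ⟩
    (a * c + - (a * d)) + (- (b * c) + b * d)          ≈⟨ +-congˡ (+-comm _ _) ⟩
    (a * c + - (a * d)) + (b * d + - (b * c))          ≈⟨ interchange _ _ _ _ ⟩
    (a * c + b * d) + (- (a * d) + - (b * c))          ≈⟨ +-congˡ (⁻¹-∙-comm _ _) ⟩
    (a * c + b * d) - (a * d + b * c)                  ∎)
    where
    minus-minus : - b * - d ≈ b * d
    minus-minus = trans (sym (-‿distribˡ-* b (- d)))
                        (trans (-‿cong (sym (-‿distribʳ-* b d))) (⁻¹-involutive _))

  difference-correct : ∀ x y → ⟦ difference x y ⟧ℤ ≈ x ⊗ 1# - y ⊗ 1#
  difference-correct zero    zero    = refl
  difference-correct zero    (suc y) = refl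
  difference-correct (suc x) zero    = refl
  difference-correct (suc x) (suc y) = trans (difference-correct x y) (sym (begin
    (1# + x ⊗ 1#) - (1# + y ⊗ 1#)  ≈⟨ sub-interchange 1# 1# _ _ ⟩
    (1# - 1#) + (x ⊗ 1# - y ⊗ 1#)  ≈⟨ +-congʳ (-‿inverseʳ 1#) ⟩
    0# + (x ⊗ 1# - y ⊗ 1#)         ≈⟨ +-identityˡ _ ⟩
    x ⊗ 1# - y ⊗ 1#                ∎))

  -‿cong₂ : ∀ {a b c d} → a ≈ b → c ≈ d → a - c ≈ b - d
  -‿cong₂ p q = +-cong p (-‿cong q)

  ⊗-homo-sum : ∀ a c b d → (a ℕ.* c ℕ.+ b ℕ.* d) ⊗ 1# ≈ (a ⊗ 1#) * (c ⊗ 1#) + (b ⊗ 1#) * (d ⊗ 1#)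
  ⊗-homo-sum a c b d = trans (×-homo-+ 1# (a ℕ.* c) (b ℕ.* d)) (+-cong (×1-homo-* a c) (×1-homo-* b d))

  embedding : integers ACR.-Raw-AlmostCommutative⟶ ACR.fromCommutativeRing R
  embedding = record
    { ⟦_⟧ = ⟦_⟧ℤ
    ; +-homo = λ { (a , b) (c , d) →
        trans (difference-correct (a ℕ.+ c) (b ℕ.+ d))
              (trans (-‿cong₂ (×-homo-+ 1# a c) (×-homo-+ 1# b d)) (sub-interchange _ _ _ _)) }
    ; *-homo = λ { (a , b) (c , d) →
        trans (difference-correct (a ℕ.* c ℕ.+ b ℕ.* d) (a ℕ.* d ℕ.+ b ℕ.* c))
              (trans (-‿cong₂ (⊗-homo-sum a c b d) (⊗-homo-sum a d b c)) (sub-product _ _ _ _)) }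
    ; -‿homo = λ { (a , b) → trans (+-comm _ _) (trans (+-congˡ (sym (⁻¹-involutive _))) (⁻¹-∙-comm _ _)) }
    ; 0-homo = -‿inverseʳ 0#
    ; 1-homo = trans (+-congˡ ε⁻¹≈ε) (trans (+-identityʳ _) (+-identityʳ _))
    }

  equal? : ∀ a b → Maybe (⟦ a ⟧ℤ ≈ ⟦ b ⟧ℤ)
  equal? (a , b) (c , d) with a ℕ.≟ c | b ℕ.≟ d
  ... | yes ≡.refl | yes ≡.refl = just refl
  ... | _          | _          = nothing

  open import Algebra.Solver.Ring integers (ACR.fromCommutativeRing R) embedding equal? public
    using (solve; _:=_; _:+_; _:*_; :-_; _:-_)

module LinearAlgebra (F : Field) where
  open Field F hiding (zero)
  open PG F
  open IntegerCoefficientSolver commRing public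
  open import Relation.Binary.Reasoning.Setoid setoid

  no-zero-divisors : ∀ {x y} → x * y ≈ 0# → ¬ y ≈ 0# → x ≈ 0#
  no-zero-divisors {x} {y} xy≈0 y≉0 with inverse y y≉0
  ... | (y⁻¹ , yy⁻¹≈1) = begin
    x                ≈⟨ sym (*-identityʳ x) ⟩
    x * 1#           ≈⟨ *-congˡ (sym yy⁻¹≈1) ⟩
    x * (y * y⁻¹)    ≈⟨ sym (*-assoc x y y⁻¹) ⟩
    (x * y) * y⁻¹    ≈⟨ *-congʳ xy≈0 ⟩
    0# * y⁻¹         ≈⟨ zeroˡ y⁻¹ ⟩
    0#               ∎

  *-nonzero : ∀ {x y} → ¬ x ≈ 0# → ¬ y ≈ 0# → ¬ x * y ≈ 0#
  *-nonzero x≉0 y≉0 xy≈0 = x≉0 (no-zero-divisors xy≈0 y≉0)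

  +-zero : ∀ {x y} → x ≈ 0# → y ≈ 0# → x + y ≈ 0#
  +-zero x≈0 y≈0 = trans (+-cong x≈0 y≈0) (+-identityʳ 0#)

  sum-cong : ∀ {m} {f g : Fin m → Carrier} → (∀ k → f k ≈ g k) → sumFin f ≈ sumFin g
  sum-cong {zero}  f≈g = refl
  sum-cong {suc m} f≈g = +-cong (f≈g zero) (sum-cong (f≈g ∘ suc))

  sum-zero : ∀ {m} {f : Fin m → Carrier} → (∀ k → f k ≈ 0#) → sumFin f ≈ 0#
  sum-zero {zero}  f≈0 = refl
  sum-zero {suc m} f≈0 = +-zero (f≈0 zero) (sum-zero (f≈0 ∘ suc))

  sum-mulˡ : ∀ {m} x (f : Fin m → Carrier) → x * sumFin f ≈ sumFin (λ k → x * f k)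
  sum-mulˡ {zero}  x f = zeroʳ x
  sum-mulˡ {suc m} x f = trans (distribˡ x _ _) (+-congˡ (sum-mulˡ x (f ∘ suc)))

  sum-mulʳ : ∀ {m} x (f : Fin m → Carrier) → sumFin f * x ≈ sumFin (λ k → f k * x)
  sum-mulʳ {zero}  x f = zeroˡ x
  sum-mulʳ {suc m} x f = trans (distribʳ x _ _) (+-congˡ (sum-mulʳ x (f ∘ suc)))

  sum-+ : ∀ {m} (f g : Fin m → Carrier) → sumFin (λ k → f k + g k) ≈ sumFin f + sumFin g
  sum-+ {zero}  f g = sym (+-identityʳ 0#)
  sum-+ {suc m} f g = trans (+-congˡ (sum-+ (f ∘ suc) (g ∘ suc)))
    (solve 4 (λ a b c d → (a :+ b) :+ (c :+ d) := (a :+ c) :+ (b :+ d)) refl _ _ _ _)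

  sum-swap : ∀ {m n} (G : Fin m → Fin n → Carrier) →
    sumFin (λ a → sumFin (λ b → G a b)) ≈ sumFin (λ b → sumFin (λ a → G a b))
  sum-swap {zero}  {n} G = sym (sum-zero {n} (λ _ → refl))
  sum-swap {suc m} G = trans (+-congˡ (sum-swap (G ∘ suc)))
                             (sym (sum-+ (G zero) (λ b → sumFin (λ a → G (suc a) b))))

  sum-exchange : ∀ {m n} (c : Fin m → Carrier) (A : Fin m → Fin n → Carrier) (y : Fin n → Carrier) →
    sumFin (λ k → c k * sumFin (λ j → A k j * y j)) ≈ sumFin (λ j → sumFin (λ k → c k * A k j) * y j)
  sum-exchange {m} {n} c A y = begin
    sumFin (λ k → c k * sumFin (λ j → A k j * y j))    ≈⟨ sum-cong {m} (λ k →
                                                            sum-mulˡ (c k) (λ j → A k j * y j)) ⟩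
    sumFin (λ k → sumFin (λ j → c k * (A k j * y j)))  ≈⟨ sum-swap {m} {n} _ ⟩
    sumFin (λ j → sumFin (λ k → c k * (A k j * y j)))  ≈⟨ sum-cong {n} (λ j → sum-cong {m} (λ k →
                                                            sym (*-assoc (c k) (A k j) (y j)))) ⟩
    sumFin (λ j → sumFin (λ k → c k * A k j * y j))    ≈⟨ sum-cong {n} (λ j →
                                                            sym (sum-mulʳ (y j) (λ k → c k * A k j))) ⟩
    sumFin (λ j → sumFin (λ k → c k * A k j) * y j)    ∎

  sum-isolate : ∀ {m} (c e : Fin m → Carrier) k → (∀ k' → k' ≢ k → e k' ≈ 0#) →
    sumFin (λ k' → c k' * e k') ≈ c k * e k
  sum-isolate {suc m} c e zero e≈0 = trans
    (+-congˡ (sum-zero (λ k → trans (*-congˡ (e≈0 (suc k) (λ ()))) (zeroʳ _))))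
    (+-identityʳ _)
  sum-isolate {suc m} c e (suc k) e≈0 = trans
    (+-cong (trans (*-congˡ (e≈0 zero (λ ()))) (zeroʳ _))
            (sum-isolate (c ∘ suc) (e ∘ suc) k (λ k' k'≢k → e≈0 (suc k') (k'≢k ∘ suc-injective))))
    (+-identityˡ _)

  sum-affine : ∀ {m} (d X Y : Fin m → Carrier) e →
    sumFin (λ k → d k * (X k - Y k * e)) ≈ sumFin (λ k → d k * X k) - sumFin (λ k → d k * Y k) * e
  sum-affine {zero}  d X Y e = sym (trans (+-congˡ (-‿cong (zeroˡ e))) (-‿inverseʳ 0#))
  sum-affine {suc m} d X Y e = trans (+-congˡ (sum-affine (d ∘ suc) (X ∘ suc) (Y ∘ suc) e))
    (solve 6 (λ d₀ x₀ y₀ e sx sy → d₀ :* (x₀ :- y₀ :* e) :+ (sx :- sy :* e)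
                                   := (d₀ :* x₀ :+ sx) :- (d₀ :* y₀ :+ sy) :* e) refl _ _ _ _ _ _)

  ev : ∀ {n} → Vect n → Vect n → Carrier
  ev g v = sumFin (λ i → g i * v i)

  ev-linear : ∀ {n d} (g : Vect d) (ws : Fin n → Vect d) (a : Fin n → Carrier) {v : Vect d} →
    (∀ i → v i ≈ sumFin (λ j → a j * ws j i)) → ev g v ≈ sumFin (λ j → a j * ev g (ws j))
  ev-linear {n} {d} g ws a {v} v≈ = begin
    sumFin (λ i → g i * v i)                          ≈⟨ sum-cong {d} (λ i → *-congˡ (trans (v≈ i)
                                                           (sum-cong {n} (λ j → *-comm (a j) (ws j i))))) ⟩
    sumFin (λ i → g i * sumFin (λ j → ws j i * a j))  ≈⟨ sum-exchange g (λ i j → ws j i) a ⟩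
    sumFin (λ j → ev g (ws j) * a j)                  ≈⟨ sum-cong {n} (λ j → *-comm _ (a j)) ⟩
    sumFin (λ j → a j * ev g (ws j))                  ∎

  relation-annihilated : ∀ {m n d} (ws : Fin n → Vect d) (v : Fin m → Vect d) (A : Fin m → Fin n → Carrier) →
    (∀ k i → v k i ≈ sumFin (λ j → A k j * ws j i)) → (c : Fin m → Carrier) →
    (∀ j → sumFin (λ k → c k * A k j) ≈ 0#) → ∀ g → sumFin (λ k → c k * ev g (v k)) ≈ 0#
  relation-annihilated {m} {n} ws v A v≈ c cA≈0 g = begin
    sumFin (λ k → c k * ev g (v k))                          ≈⟨ sum-cong {m} (λ k →
                                                                  *-congˡ (ev-linear g ws (A k) (v≈ k))) ⟩
    sumFin (λ k → c k * sumFin (λ j → A k j * ev g (ws j)))  ≈⟨ sum-exchange c A (ev g ∘ ws) ⟩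
    sumFin (λ j → sumFin (λ k → c k * A k j) * ev g (ws j))  ≈⟨ sum-zero {n} (λ j →
                                                                  trans (*-congʳ (cA≈0 j)) (zeroˡ _)) ⟩
    0#                                                        ∎

  record RowRelation {m n} (A : Fin m → Fin n → Carrier) : Set where
    field
      coeff    : Fin m → Carrier
      support  : Fin m
      coeff≉0  : ¬ coeff support ≈ 0#
      relation : ∀ j → sumFin (λ k → coeff k * A k j) ≈ 0#

  zeroRowRelation : ∀ {m n} (A : Fin (suc m) → Fin n → Carrier) → (∀ j → A zero j ≈ 0#) → RowRelation A
  zeroRowRelation {m} A A₀≈0 = record
    { coeff    = λ { zero → 1# ; (suc _) → 0# }
    ; support  = zero
    ; coeff≉0  = 1≉0
    ; relation = λ j → +-zero (trans (*-identityˡ _) (A₀≈0 j)) (sum-zero {m} (λ k → zeroˡ (A (suc k) j)))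
    }

  -- One step of Gaussian elimination: with the pivot A₀ₚ (inverse a⁻¹), clear column p from the
  -- other rows and delete it; a relation among the rows of the smaller matrix lifts to A.
  module PivotStep {m n} (A : Fin (suc (suc m)) → Fin (suc n) → Carrier) (p : Fin (suc n))
                   (a⁻¹ : Carrier) (pivot : A zero p * a⁻¹ ≈ 1#) where

    cleared : Fin (suc m) → Fin n → Carrier
    cleared k j = A (suc k) (punchIn p j) - A (suc k) p * (a⁻¹ * A zero (punchIn p j))

    liftRelation : RowRelation cleared → RowRelation A
    liftRelation rel = record
      { coeff = coeff′ ; support = suc support ; coeff≉0 = coeff≉0 ; relation = relation′ }
      where
      open RowRelation rel
      S : Carrier
      S = sumFin (λ k → coeff k * A (suc k) p)
      coeff′ : Fin (suc (suc m)) → Carrier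
      coeff′ zero    = - (S * a⁻¹)
      coeff′ (suc k) = coeff k
      Vanishes : Fin (suc n) → Set
      Vanishes i = - (S * a⁻¹) * A zero i + sumFin (λ k → coeff k * A (suc k) i) ≈ 0#
      pivot-column : Vanishes p
      pivot-column = begin
        - (S * a⁻¹) * A zero p + S  ≈⟨ solve 3 (λ s i a → (:- (s :* i)) :* a :+ s := s :- s :* (a :* i))
                                             refl S a⁻¹ (A zero p) ⟩
        S - S * (A zero p * a⁻¹)    ≈⟨ +-congˡ (-‿cong (trans (*-congˡ pivot) (*-identityʳ S))) ⟩
        S - S                       ≈⟨ -‿inverseʳ S ⟩
        0#                          ∎
      other-column : ∀ j → Vanishes (punchIn p j)
      other-column j = begin
        - (S * a⁻¹) * A₀ⱼ + X                 ≈⟨ solve 4 (λ s i a x → (:- (s :* i)) :* a :+ x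
                                                                  := x :- s :* (i :* a)) refl S a⁻¹ A₀ⱼ X ⟩
        X - S * (a⁻¹ * A₀ⱼ)                   ≈⟨ sym (sum-affine coeff (λ k → A (suc k) (punchIn p j))
                                                                       (λ k → A (suc k) p) _) ⟩
        sumFin (λ k → coeff k * cleared k j)  ≈⟨ relation j ⟩
        0#                                    ∎
        where
        A₀ⱼ = A zero (punchIn p j)
        X   = sumFin (λ k → coeff k * A (suc k) (punchIn p j))
      relation′ : ∀ j → sumFin (λ k → coeff′ k * A k j) ≈ 0#
      relation′ j with p Fin.≟ j
      ... | yes ≡.refl = pivot-column
      ... | no p≢j     = ≡.subst Vanishes (punchIn-punchOut p≢j) (other-column (punchOut p≢j))

  -- A family of functionals G dual to the vectors v: Gₖ vanishes at every vₖ' with k' ≠ k but not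
  -- at vₖ.  Such a family witnesses that the vₖ are linearly independent.
  record IsDualFamily {m d} (v G : Fin m → Vect d) : Set where
    field
      off-diagonal : ∀ k k' → k' ≢ k → ev (G k) (v k') ≈ 0#
      diagonal     : ∀ k → ¬ ev (G k) (v k) ≈ 0#

  dualFamily-++ : ∀ {a b d} {u G : Fin a → Vect d} {w H : Fin b → Vect d} →
    IsDualFamily u G → IsDualFamily w H →
    (∀ i j → ev (G i) (w j) ≈ 0#) → (∀ j i → ev (H j) (u i) ≈ 0#) →
    IsDualFamily (u ++ w) (G ++ H)
  dualFamily-++ {a} {u = u} {G} {w} {H} uG wH Gw≈0 Hu≈0 =
    record { off-diagonal = off ; diagonal = diag }
    where
    module U = IsDualFamily uG
    module W = IsDualFamily wH
    off : ∀ k k' → k' ≢ k → ev ((G ++ H) k) ((u ++ w) k') ≈ 0#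
    off k k' k'≢k with splitAt a k in k≡ | splitAt a k' in k'≡
    ... | inj₁ i | inj₁ i' = U.off-diagonal i i' λ { ≡.refl →
                               k'≢k (≡.trans (≡.sym (splitAt⁻¹-↑ˡ k'≡)) (splitAt⁻¹-↑ˡ k≡)) }
    ... | inj₁ i | inj₂ j' = Gw≈0 i j'
    ... | inj₂ j | inj₁ i' = Hu≈0 j i'
    ... | inj₂ j | inj₂ j' = W.off-diagonal j j' λ { ≡.refl →
                               k'≢k (≡.trans (≡.sym (splitAt⁻¹-↑ʳ k'≡)) (splitAt⁻¹-↑ʳ k≡)) }
    diag : ∀ k → ¬ ev ((G ++ H) k) ((u ++ w) k) ≈ 0#
    diag k with splitAt a k
    ... | inj₁ i = U.diagonal i
    ... | inj₂ j = W.diagonal j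

  module _ (_≟_ : Decidable _≈_) where

    nonzeroEntry : ∀ {n} (f : Fin n → Carrier) → (∃ λ p → ¬ f p ≈ 0#) ⊎ (∀ p → f p ≈ 0#)
    nonzeroEntry {zero}  f = inj₂ (λ ())
    nonzeroEntry {suc n} f with f zero ≟ 0# | nonzeroEntry (f ∘ suc)
    ... | no f₀≉0  | _               = inj₁ (zero , f₀≉0)
    ... | yes _    | inj₁ (p , fₚ≉0) = inj₁ (suc p , fₚ≉0)
    ... | yes f₀≈0 | inj₂ f≈0        = inj₂ λ { zero → f₀≈0 ; (suc p) → f≈0 p }

    rowRelation : ∀ {m n} → n ≤ m → (A : Fin (suc m) → Fin n → Carrier) → RowRelation A
    rowRelation {m}     {zero}  _         A = zeroRowRelation A (λ ())
    rowRelation {suc m} {suc n} (s≤s n≤m) A with nonzeroEntry (A zero)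
    ... | inj₂ A₀≈0       = zeroRowRelation A A₀≈0
    ... | inj₁ (p , A₀ₚ≉0) with inverse (A zero p) A₀ₚ≉0
    ...   | (a⁻¹ , pivot) = liftRelation (rowRelation n≤m cleared)
      where open PivotStep A p a⁻¹ pivot

    dualFamily⇒notInSpan : ∀ {m n d} → n ≤ m → {v G : Fin (suc m) → Vect d} → IsDualFamily v G →
      (ws : Fin n → Vect d) → ¬ (∀ k → InSpan ws (v k))
    dualFamily⇒notInSpan {m} {n} n≤m {v} {G} dual ws v∈span =
      coeff≉0 (no-zero-divisors Gv≈0 (diagonal support))
      where
      open IsDualFamily dual
      A : Fin (suc m) → Fin n → Carrier
      A k = proj₁ (v∈span k)
      open RowRelation (rowRelation n≤m A)
      Gv≈0 : coeff support * ev (G support) (v support) ≈ 0#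
      Gv≈0 = trans (sym (sum-isolate coeff (λ k → ev (G support) (v k)) support (off-diagonal support)))
                   (relation-annihilated ws v A (λ k → proj₂ (v∈span k)) coeff relation (G support))

module QuinticSurface (F : Field) where
  open Field F hiding (zero)
  open PG F
  open LinearAlgebra F
  open import Algebra.Properties.Group +-group using (x∙y⁻¹≈ε⇒x≈y; x≈y⇒x∙y⁻¹≈ε)

  ∏ : ∀ {d} → (Fin (suc d) → Carrier) → Carrier
  ∏ {zero}  f = f zero
  ∏ {suc d} f = f zero * ∏ (f ∘ suc)

  ∏-zero : ∀ {d} (f : Fin (suc d) → Carrier) j → f j ≈ 0# → ∏ f ≈ 0#
  ∏-zero {zero}  f zero    f≈0 = f≈0
  ∏-zero {suc d} f zero    f≈0 = trans (*-congʳ f≈0) (zeroˡ _)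
  ∏-zero {suc d} f (suc j) f≈0 = trans (*-congˡ (∏-zero (f ∘ suc) j f≈0)) (zeroʳ _)

  ∏-nonzero : ∀ {d} (f : Fin (suc d) → Carrier) → (∀ j → ¬ f j ≈ 0#) → ¬ ∏ f ≈ 0#
  ∏-nonzero {zero}  f f≉0 = f≉0 zero
  ∏-nonzero {suc d} f f≉0 = *-nonzero (f≉0 zero) (∏-nonzero (f ∘ suc) (f≉0 ∘ suc))

  L : Param → Param → Carrier
  L (sA , tA) (s , t) = sA * t - tA * s

  L-self : ∀ A → L A A ≈ 0#
  L-self (sA , tA) = trans (+-congˡ (-‿cong (*-comm tA sA))) (-‿inverseʳ _)

  L-nonzero : ∀ θ A → ¬ SameParam θ A → ¬ L A θ ≈ 0#
  L-nonzero (s , t) (sA , tA) θ≉A L≈0 =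
    θ≉A (trans (*-comm s tA) (trans (sym (x∙y⁻¹≈ε⇒x≈y _ _ L≈0)) (*-comm sA t)))

  act-injective : ∀ φ θ θ' → SameParam (act φ θ) (act φ θ') → SameParam θ θ'
  act-injective φ (s , t) (s' , t') φθ≡φθ' =
    x∙y⁻¹≈ε⇒x≈y _ _ (no-zero-divisors (trans (*-comm _ _) det·L≈0) det≉0)
    where
    open PGL2 φ
    -- (ad − bc)·(st' − ts') is the 2×2 determinant of the images of θ and θ'
    det·L≈0 : (a * d - b * c) * (s * t' - t * s') ≈ 0#
    det·L≈0 = trans
      (solve 8 (λ a b c d s t s' t' →
         (a :* d :- b :* c) :* (s :* t' :- t :* s')
         := (c :* t :+ d :* s) :* (a :* t' :+ b :* s') :- (a :* t :+ b :* s) :* (c :* t' :+ d :* s'))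
        refl a b c d s t s' t')
      (x≈y⇒x∙y⁻¹≈ε φθ≡φθ')

  ev-blocks : ∀ g v → ev {7} g v ≈
    (g (# 0) * v (# 0) + (g (# 1) * v (# 1) + g (# 2) * v (# 2))) +
    (g (# 3) * v (# 3) + (g (# 4) * v (# 4) + (g (# 5) * v (# 5) + g (# 6) * v (# 6))))
  ev-blocks g v = trans (+-congˡ (+-congˡ (+-congˡ (+-congˡ (+-congˡ (+-congˡ (+-identityʳ _)))))))
    (solve 7 (λ a b c d e f h → a :+ (b :+ (c :+ (d :+ (e :+ (f :+ h)))))
                              := (a :+ (b :+ c)) :+ (d :+ (e :+ (f :+ h)))) refl _ _ _ _ _ _ _)

  -- the functional on α whose value at the conic point P(θ) is L A θ · L B θ
  quadraticForm : Param → Param → Vect 7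
  quadraticForm (sA , tA) (sB , tB) zero                  = tA * tB
  quadraticForm (sA , tA) (sB , tB) (suc zero)            = - (sA * tB + tA * sB)
  quadraticForm (sA , tA) (sB , tB) (suc (suc zero))      = sA * sB
  quadraticForm (sA , tA) (sB , tB) (suc (suc (suc _)))   = 0#

  -- the functional on Π₃ whose value at the cubic point N(η) is L A η · L B η · L C η
  cubicForm : Param → Param → Param → Vect 7
  cubicForm (sA , tA) (sB , tB) (sC , tC) (suc (suc (suc zero))) =
    - (tA * tB * tC)
  cubicForm (sA , tA) (sB , tB) (sC , tC) (suc (suc (suc (suc zero)))) =
    sA * tB * tC + tA * sB * tC + tA * tB * sC
  cubicForm (sA , tA) (sB , tB) (sC , tC) (suc (suc (suc (suc (suc zero))))) =
    - (sA * sB * tC + sA * tB * sC + tA * sB * sC)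
  cubicForm (sA , tA) (sB , tB) (sC , tC) (suc (suc (suc (suc (suc (suc zero)))))) =
    sA * sB * sC
  cubicForm _ _ _ _ = 0#

  conicDual : (Fin 2 → Param) → Vect 7
  conicDual ρ = quadraticForm (ρ (# 0)) (ρ (# 1))

  cubicDual : (Fin 3 → Param) → Vect 7
  cubicDual ρ = cubicForm (ρ (# 0)) (ρ (# 1)) (ρ (# 2))

  quadraticForm-conic : ∀ A B θ → ev (quadraticForm A B) (conicPt θ) ≈ L A θ * L B θ
  quadraticForm-conic A@(sA , tA) B@(sB , tB) θ@(s , t) =
    trans (ev-blocks (quadraticForm A B) (conicPt θ)) (trans
    (+-cong (solve 6 (λ sA tA sB tB s t →
               (tA :* tB) :* (s :* s) :+ ((:- (sA :* tB :+ tA :* sB)) :* (s :* t) :+ (sA :* sB) :* (t :* t))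
               := (sA :* t :- tA :* s) :* (sB :* t :- tB :* s)) refl sA tA sB tB s t)
            (+-zero (zeroˡ _) (+-zero (zeroˡ _) (+-zero (zeroˡ _) (zeroˡ _)))))
    (+-identityʳ _))

  quadraticForm-cubic : ∀ A B η → ev (quadraticForm A B) (cubicPt η) ≈ 0#
  quadraticForm-cubic A B η = trans (ev-blocks (quadraticForm A B) (cubicPt η))
    (+-zero (+-zero (zeroʳ _) (+-zero (zeroʳ _) (zeroʳ _)))
            (+-zero (zeroˡ _) (+-zero (zeroˡ _) (+-zero (zeroˡ _) (zeroˡ _)))))

  cubicForm-conic : ∀ A B C θ → ev (cubicForm A B C) (conicPt θ) ≈ 0#
  cubicForm-conic A B C θ = trans (ev-blocks (cubicForm A B C) (conicPt θ))
    (+-zero (+-zero (zeroˡ _) (+-zero (zeroˡ _) (zeroˡ _)))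
            (+-zero (zeroʳ _) (+-zero (zeroʳ _) (+-zero (zeroʳ _) (zeroʳ _)))))

  cubicForm-cubic : ∀ A B C η → ev (cubicForm A B C) (cubicPt η) ≈ L A η * (L B η * L C η)
  cubicForm-cubic A@(sA , tA) B@(sB , tB) C@(sC , tC) η@(s , t) =
    trans (ev-blocks (cubicForm A B C) (cubicPt η)) (trans
    (+-cong (+-zero (zeroˡ _) (+-zero (zeroˡ _) (zeroˡ _)))
            (solve 8 (λ sA tA sB tB sC tC s t →
               (:- (tA :* tB :* tC)) :* (s :* s :* s)
               :+ ((sA :* tB :* tC :+ tA :* sB :* tC :+ tA :* tB :* sC) :* (s :* s :* t)
               :+ ((:- (sA :* sB :* tC :+ sA :* tB :* sC :+ tA :* sB :* sC)) :* (s :* t :* t)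
               :+ sA :* sB :* sC :* (t :* t :* t)))
               := (sA :* t :- tA :* s) :* ((sB :* t :- tB :* s) :* (sC :* t :- tC :* s)))
              refl sA tA sB tB sC tC s t))
    (+-identityˡ _))

  clamp : ∀ {d r} → Fin (suc d) → Fin (suc r)
  clamp {r = zero}          _       = zero
  clamp {r = suc r}         zero    = zero
  clamp {suc d} {r = suc r} (suc j) = suc (clamp j)

  clamp-surjective : ∀ {d r} → r ≤ d → (x : Fin (suc r)) → ∃ λ j → clamp {d} j ≡ x
  clamp-surjective {r = zero}  _ zero = zero , ≡.refl
  clamp-surjective {r = suc r} _ zero = zero , ≡.refl
  clamp-surjective {suc d} {suc r} (s≤s r≤d) (suc x) with clamp-surjective r≤d x
  ... | j , ≡.refl = suc j , ≡.refl

  CutOutByProducts : ∀ d → (Param → Vect 7) → ((Fin (suc d) → Param) → Vect 7) → Set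
  CutOutByProducts d P D = ∀ ρ θ → ev (D ρ) (P θ) ≈ ∏ (λ j → L (ρ j) θ)

  conic-cutOut : CutOutByProducts 1 conicPt conicDual
  conic-cutOut ρ = quadraticForm-conic (ρ (# 0)) (ρ (# 1))

  twistedCubic-cutOut : CutOutByProducts 2 cubicPt cubicDual
  twistedCubic-cutOut ρ = cubicForm-cubic (ρ (# 0)) (ρ (# 1)) (ρ (# 2))

  Separated : ∀ {r} → (Fin r → Param) → Set
  Separated θs = ∀ i j → SameParam (θs i) (θs j) → i ≡ j

  -- the functional through all the parameters except θₖ (some repeated, to fill the d + 1 slots)
  rootDuals : ∀ {d r} → ((Fin (suc d) → Param) → Vect 7) → (Fin (suc (suc r)) → Param) →
    Fin (suc (suc r)) → Vect 7
  rootDuals D θs k = D (θs ∘ punchIn k ∘ clamp)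

  rootDuals-dual : ∀ {d r P D} → CutOutByProducts d P D → r ≤ d →
    (θs : Fin (suc (suc r)) → Param) → Separated θs → IsDualFamily (P ∘ θs) (rootDuals D θs)
  rootDuals-dual {d} {r} {P} {D} cutOut r≤d θs separated =
    record { off-diagonal = off ; diagonal = diag }
    where
    off : ∀ k k' → k' ≢ k → ev (rootDuals D θs k) (P (θs k')) ≈ 0#
    off k k' k'≢k with clamp-surjective r≤d (punchOut (k'≢k ∘ ≡.sym))
    ... | j , clamp≡ = trans (cutOut _ _) (∏-zero _ j (≡.subst (λ i → L (θs i) (θs k') ≈ 0#)
            (≡.sym (≡.trans (≡.cong (punchIn k) clamp≡) (punchIn-punchOut (k'≢k ∘ ≡.sym))))
            (L-self (θs k'))))
    diag : ∀ k → ¬ ev (rootDuals D θs k) (P (θs k)) ≈ 0#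
    diag k Dθₖ≈0 = ∏-nonzero (λ (j : Fin (suc d)) → L (θs (punchIn k (clamp j))) (θs k))
      (λ j → L-nonzero (θs k) (θs (punchIn k (clamp j)))
               (λ same → punchInᵢ≢i k (clamp j) (≡.sym (separated k _ same))))
      (trans (sym (cutOut (θs ∘ punchIn k ∘ clamp) (θs k))) Dθₖ≈0)

  InSpan-resp : ∀ {n} {ws : Fin n → Vect 7} {v v' : Vect 7} → (∀ i → v i ≈ v' i) →
    InSpan ws v → InSpan ws v'
  InSpan-resp v≈v' (a , v≈) = a , λ i → trans (sym (v≈v' i)) (v≈ i)

  conicPt-inSpan : ∀ {n} φ θ (ws : Fin n → Vect 7) → GenInSpan φ θ ws → InSpan ws (conicPt θ)
  conicPt-inSpan φ θ ws gen =
    InSpan-resp (λ i → trans (+-cong (*-identityˡ _) (zeroˡ _)) (+-identityʳ _)) (gen 1# 0#)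

  cubicPt-inSpan : ∀ {n} φ θ (ws : Fin n → Vect 7) → GenInSpan φ θ ws → InSpan ws (cubicPt (act φ θ))
  cubicPt-inSpan φ θ ws gen =
    InSpan-resp (λ i → trans (+-cong (zeroˡ _) (*-identityˡ _)) (+-identityˡ _)) (gen 0# 1#)

  module _ (_≟_ : Decidable _≈_) where

    notInCommonSpace : ∀ {c r k} (φ : PGL2) (θs : Fin (suc (suc r)) → Param) → Separated θs →
      (ι : Fin (suc (suc c)) → Fin (suc (suc r))) → (∀ {i j} → ι i ≡ ι j → i ≡ j) →
      c ≤ 1 → r ≤ 2 → suc k ≤ suc (c ℕ.+ suc (suc r)) → ¬ InCommonSpace φ θs k
    notInCommonSpace {c} {r} φ θs separated ι ι-injective c≤1 r≤2 k<points (ws , gens) =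
      dualFamily⇒notInSpan _≟_ k<points dual ws inSpan
      where
      conicθs : Fin (suc (suc c)) → Param
      conicθs = θs ∘ ι
      cubicθs : Fin (suc (suc r)) → Param
      cubicθs = act φ ∘ θs
      dual : IsDualFamily ((conicPt ∘ conicθs) ++ (cubicPt ∘ cubicθs))
                          (rootDuals conicDual conicθs ++ rootDuals cubicDual cubicθs)
      dual = dualFamily-++
        (rootDuals-dual {P = conicPt} {D = conicDual} conic-cutOut c≤1 conicθs
           (λ i j same → ι-injective (separated (ι i) (ι j) same)))
        (rootDuals-dual {P = cubicPt} {D = cubicDual} twistedCubic-cutOut r≤2 cubicθs
           (λ i j same → separated i j (act-injective φ (θs i) (θs j) same)))
        (λ i j → quadraticForm-cubic _ _ (cubicθs j))
        (λ j i → cubicForm-conic _ _ _ (conicθs i))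
      inSpan : ∀ k → InSpan ws (((conicPt ∘ conicθs) ++ (cubicPt ∘ cubicθs)) k)
      inSpan k with splitAt (suc (suc c)) k
      ... | inj₁ i = conicPt-inSpan φ (conicθs i) ws (gens (ι i))
      ... | inj₂ j = cubicPt-inSpan φ (θs j) ws (gens j)

module _ (F : Field) {q} (size : HasSize F q) where
  open Field F
  open HasSize size

  finite⇒decidable : Decidable _≈_
  finite⇒decidable x y with enum-surj x | enum-surj y
  ... | (i , eᵢ≈x) | (j , eⱼ≈y) with i Fin.≟ j
  ...   | yes ≡.refl = yes (trans (sym eᵢ≈x) eⱼ≈y)
  ...   | no i≢j     = no λ x≈y → i≢j (enum-inj i j (trans eᵢ≈x (trans x≈y (sym eⱼ≈y))))

-- Two generators are separated by their 2 conic and 2 cubic points, three by 3 + 3 points and four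
-- by 3 + 4 points (only three points of the conic can be independent).
theorem2p2 : (F : Field) (q : ℕ) → HasSize F q → IsPrimePower q → q ≥ 6 →
    (φ : PG.PGL2 F) →
      ((θs : Fin 2 → PG.Param F) → PG.DistinctParams F θs → ¬ PG.InCommonSpace F φ θs 2)
    × ((θs : Fin 3 → PG.Param F) → PG.DistinctParams F θs → ¬ PG.InCommonSpace F φ θs 4)
    × ((θs : Fin 4 → PG.Param F) → PG.DistinctParams F θs → ¬ PG.InCommonSpace F φ θs 5)
theorem2p2 F q size _ _ φ =
    (λ θs distinct → notInCommonSpace _≟_ φ θs (proj₂ distinct) id id z≤n z≤n ℕₚ.≤-refl)
  , (λ θs distinct → notInCommonSpace _≟_ φ θs (proj₂ distinct) id id (s≤s z≤n) (s≤s z≤n) ℕₚ.≤-refl)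
  , (λ θs distinct → notInCommonSpace _≟_ φ θs (proj₂ distinct) inject₁ inject₁-injective
                                      (s≤s z≤n) (s≤s (s≤s z≤n)) ℕₚ.≤-refl)
  where
  open QuinticSurface F using (notInCommonSpace)
  _≟_ : Decidable (Field._≈_ F)
  _≟_ = finite⇒decidable F size
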